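{- Let $V=\{1,\dots,n\}$, let $0<\lambda_1<\cdots<\lambda_k\le n$ be integers with $\lambda_1>1$, $\lambda_{i+1}-\lambda_i\le\lambda_1$ for all $i=1,\dots,k-1$, and $\lambda_1+\lambda_k=n$, and let $\mathcal H=\bigcup_{j=1}^k\binom{V}{\lambda_j}$. Then for every long position $x\in\mathbb Z_{\ge0}^V$ and every integer $z$ with $m(x)\le z<\mathcal T_{\mathcal H}(x)$ there exists a move $x\to x'$ in $NIM_{\mathcal H}$ such that $x'$ is long and $\mathcal T_{\mathcal H}(x')=z$.
   Context: $\binom{V}{t}$ is the family of $t$-element subsets of $V$. Hypergraph NIM $NIM_{\mathcal H}$: positions are $x\in\mathbb Z_{\ge0}^V$; a move $x\to x'$ chooses $H\in\mathcal H$ and strictly decreases every coordinate $x_i$, $i\in H$ (to nonnegative values), leaving the other coordinates unchanged. The Tetris value $\mathcal T_{\mathcal H}(x)$ is the maximum number of consecutive moves that can be made starting from $x$. With $e$ the all-ones vector, $m(x)=\min_{i\in V}x_i$ and $y_{\mathcal H}(x)=\mathcal T_{\mathcal H}(x-m(x)e)+1$. A position $x$ is called long if $m(x)\le\binom{y_{\mathcal H}(x)}{2}$. -}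

module Defs where

open import Data.Nat using (ℕ; zero; suc; _+_; _∸_; _≤_; _<_; _⊓_)
open import Data.Nat.Combinatorics using (_C_)
open import Data.Fin using (Fin; inject₁; fromℕ) renaming (zero to fzero; suc to fsuc)
open import Data.Fin.Subset using (Subset; _∈_; _∉_; ∣_∣)
open import Data.Product using (Σ; ∃; _×_)
open import Relation.Binary.PropositionalEquality using (_≡_)

Position : ℕ → Set
Position n = Fin n → ℕ

Hypergraph : ℕ → Set₁
Hypergraph n = Subset n → Set

UnionOfLayers : ∀ {n k} → (Fin k → ℕ) → Hypergraph n
UnionOfLayers {k = k} λs H = Σ (Fin k) λ j → ∣ H ∣ ≡ λs j

Move : ∀ {n} → Hypergraph n → Position n → Position n → Set
Move {n} 𝓗 x x' = Σ (Subset n) λ H → 𝓗 H ×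
  ((i : Fin n) → (i ∈ H → x' i < x i) × (i ∉ H → x' i ≡ x i))

data Play {n} (𝓗 : Hypergraph n) : Position n → ℕ → Set where
  stop : ∀ {x} → Play 𝓗 x 0
  step : ∀ {x x' t} → Move 𝓗 x x' → Play 𝓗 x' t → Play 𝓗 x (suc t)

-- IsTetris 𝓗 x t : T_H(x) = t, i.e. t is the maximum number of
-- consecutive moves that can be made from x.
IsTetris : ∀ {n} → Hypergraph n → Position n → ℕ → Set
IsTetris 𝓗 x t = Play 𝓗 x t × (∀ s → Play 𝓗 x s → s ≤ t)

-- m(x) = min_i x_i  (convention m = 0 when V is empty; irrelevant here).
minPos : ∀ {n} → Position n → ℕ
minPos {zero} x = 0
minPos {suc zero} x = x fzero
minPos {suc (suc n)} x = x fzero ⊓ minPos {suc n} (λ i → x (fsuc i))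

reduce : ∀ {n} → Position n → Position n
reduce x i = x i ∸ minPos x

-- x is long iff m(x) ≤ binom(y_H(x), 2), where y_H(x) = T_H(x - m(x)e) + 1.
Long : ∀ {n} → Hypergraph n → Position n → Set
Long 𝓗 x = ∃ λ t → IsTetris 𝓗 (reduce x) t × minPos x ≤ (suc t) C 2

module Submission where

-- With l = λ₀, the Tetris value of x is the largest t with l·t ≤ Σᵢ min(xᵢ, t)
-- (its "value"): every move uses at least l cells of the lowest t levels,
-- and conversely some l-set can always be lowered.  Lowering one
-- coordinate decreases the value by at most one, so every value between
-- those of two comparable positions is attained in between (a discrete
-- intermediate value theorem).  The theorem then reduces to exhibiting,
-- for each z, a hyperedge S and two comparable positions that agree with x
-- off S and lie below x lowered on S, the upper one admitting z rounds and
-- the lower one not z+1.  They are built from the heaviest coordinates of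
-- x (or of x with its minimum cleared), cleared or lowered, searching
-- through the levels λ_j, whose gaps are at most l; the new
-- position is long either because it has a zero coordinate or because it
-- inherits longness from x.

open import Defs
open import Data.Nat using (ℕ; zero; suc; _+_; _*_; _∸_; _≤_; _<_; _≤′_; ≤′-reflexive; ≤′-step; _⊓_; z≤n; s≤s; _≤?_; _<?_)
open import Data.Nat.Properties hiding (_≟_)
open import Data.Nat.Combinatorics using (_C_; nCk+nC[k+1]≡[n+1]C[k+1])
open import Data.Bool using (Bool; true; false; if_then_else_; not; _∧_; _∨_)
open import Data.Bool.Properties using (∧-zeroʳ; ∨-conicalˡ; ∨-conicalʳ; ∨-zeroʳ) renaming (_≟_ to _≟ᵇ_)
open import Data.Fin using (Fin; inject₁; fromℕ; toℕ) renaming (zero to fzero; suc to fsuc)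
open import Data.Fin.Properties using (_≟_; any?)
open import Data.Fin.Subset using (Subset; _∈_; _∉_; ∣_∣)
open import Data.Vec using ([]; _∷_; lookup; tabulate)
open import Data.Vec.Properties using ([]=⇒lookup; lookup⇒[]=; lookup∘tabulate)
open import Data.Product using (Σ; ∃; _×_; _,_; proj₁; proj₂; map₂)
open import Data.Sum using (_⊎_; inj₁; inj₂)
open import Data.Empty using (⊥-elim)
open import Relation.Nullary using (¬_; Dec; yes; no; _×-dec_)
open import Relation.Nullary.Decidable using (⌊_⌋; ⌊⌋-map′)
open import Relation.Binary.PropositionalEquality using (_≡_; _≢_; refl; sym; trans; cong; cong₂; subst; subst₂; module ≡-Reasoning)
open import Algebra.Properties.Semiring.Sum +-*-semiring using (sum; sum-cong-≗; ∑-distrib-+; *-distribˡ-sum)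

witness : ∀ {A : Set} (d : Dec A) → ⌊ d ⌋ ≡ true → A
witness (yes a) _ = a

confirm : ∀ {A : Set} (d : Dec A) → A → ⌊ d ⌋ ≡ true
confirm (yes _) _ = refl
confirm (no ¬a) a = ⊥-elim (¬a a)

refutation : ∀ {A : Set} (d : Dec A) → ⌊ d ⌋ ≡ false → ¬ A
refutation (no ¬a) _ = ¬a

deny : ∀ {A : Set} (d : Dec A) → ¬ A → ⌊ d ⌋ ≡ false
deny (yes a) ¬a = ⊥-elim (¬a a)
deny (no _) _ = refl

false≢true : false ≢ true
false≢true ()

not-true : ∀ {b} → not b ≡ true → b ≡ false
not-true {false} _ = refl

not-false : ∀ {b} → not b ≡ false → b ≡ true
not-false {true} _ = refl

propagate : ∀ (P : ℕ → Set) → (∀ j → P j → P (suc j)) → ∀ {i j} → i ≤ j → P i → P j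
propagate P next i≤j Pi = along (≤⇒≤′ i≤j)
  where
  along : ∀ {j} → _ ≤′ j → P j
  along (≤′-reflexive refl) = Pi
  along (≤′-step i≤′j) = next _ (along i≤′j)

-- Subsets of Fin n as boolean predicates; they are converted to the
-- vector-based 'Subset n' of the hypergraph only when a move is built.
Subsetᵇ : ℕ → Set
Subsetᵇ n = Fin n → Bool

𝟙 : Bool → ℕ
𝟙 true = 1
𝟙 false = 0

count : ∀ {n} → Subsetᵇ n → ℕ
count S = sum (λ i → 𝟙 (S i))

_⊆ᵇ_ : ∀ {n} → Subsetᵇ n → Subsetᵇ n → Set
P ⊆ᵇ Q = ∀ i → P i ≡ true → Q i ≡ true

_∪ᵇ_ : ∀ {n} → Subsetᵇ n → Subsetᵇ n → Subsetᵇ n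
(P ∪ᵇ Q) i = P i ∨ Q i

｛_｝ : ∀ {n} → Fin n → Subsetᵇ n
｛ i ｝ j = ⌊ j ≟ i ⌋

∅ᵇ : ∀ {n} → Subsetᵇ n
∅ᵇ _ = false

sum-mono : ∀ {n} {f g : Fin n → ℕ} → (∀ i → f i ≤ g i) → sum f ≤ sum g
sum-mono {zero} f≤g = z≤n
sum-mono {suc n} f≤g = +-mono-≤ (f≤g fzero) (sum-mono (λ i → f≤g (fsuc i)))

count-mono : ∀ {n} {P Q : Subsetᵇ n} → P ⊆ᵇ Q → count P ≤ count Q
count-mono {P = P} P⊆Q = sum-mono (λ i → 𝟙-mono (P i) (P⊆Q i))
  where
  𝟙-mono : ∀ a {b} → (a ≡ true → b ≡ true) → 𝟙 a ≤ 𝟙 b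
  𝟙-mono false _ = z≤n
  𝟙-mono true a⇒b rewrite a⇒b refl = ≤-refl

count-none : ∀ {n} (S : Subsetᵇ n) → (∀ i → S i ≡ false) → count S ≡ 0
count-none {zero} S _ = refl
count-none {suc n} S none rewrite none fzero = count-none (λ i → S (fsuc i)) (λ i → none (fsuc i))

count-empty : ∀ {n} → count (∅ᵇ {n}) ≡ 0
count-empty {n} = count-none {n} ∅ᵇ (λ _ → refl)

count-all : ∀ {n} (S : Subsetᵇ n) → (∀ i → S i ≡ true) → count S ≡ n
count-all {zero} S _ = refl
count-all {suc n} S all rewrite all fzero = cong suc (count-all (λ i → S (fsuc i)) (λ i → all (fsuc i)))

count≤ : ∀ {n} (S : Subsetᵇ n) → count S ≤ n
count≤ {zero} S = z≤n
count≤ {suc n} S with S fzero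
... | true = s≤s (count≤ (λ i → S (fsuc i)))
... | false = m≤n⇒m≤1+n (count≤ (λ i → S (fsuc i)))

count-singleton : ∀ {n} (i : Fin n) → count ｛ i ｝ ≡ 1
count-singleton {suc n} fzero = cong suc (count-none {n} (λ j → ｛ fzero ｝ (fsuc j)) (λ j → refl))
count-singleton {suc n} (fsuc i) =
  trans (sum-cong-≗ (λ j → cong 𝟙 (⌊⌋-map′ _ _ (j ≟ i)))) (count-singleton i)

count-split : ∀ {n} (S P Q : Subsetᵇ n) → (∀ i → 𝟙 (S i) ≡ 𝟙 (P i) + 𝟙 (Q i)) →
              count S ≡ count P + count Q
count-split S P Q split = trans (sum-cong-≗ split) (∑-distrib-+ (λ i → 𝟙 (P i)) (λ i → 𝟙 (Q i)))

count-complement : ∀ {n} (S : Subsetᵇ n) → count S + count (λ i → not (S i)) ≡ n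
count-complement {n} S =
  trans (sym (count-split (λ _ → true) S (λ i → not (S i)) split)) (count-all (λ _ → true) (λ _ → refl))
  where
  split : ∀ i → 1 ≡ 𝟙 (S i) + 𝟙 (not (S i))
  split i with S i
  ... | true = refl
  ... | false = refl

count-insert : ∀ {n} (S : Subsetᵇ n) i → S i ≡ false → count (S ∪ᵇ ｛ i ｝) ≡ count S + 1
count-insert S i Si≡false =
  trans (count-split (S ∪ᵇ ｛ i ｝) S ｛ i ｝ split) (cong (count S +_) (count-singleton i))
  where
  split : ∀ j → 𝟙 (S j ∨ ｛ i ｝ j) ≡ 𝟙 (S j) + 𝟙 (｛ i ｝ j)
  split j with j ≟ i
  ... | yes refl rewrite Si≡false = refl
  ... | no _ with S j
  ...   | true = refl
  ...   | false = refl

count-strict : ∀ {n} (P S : Subsetᵇ n) i → P ⊆ᵇ S → S i ≡ true → P i ≡ false → suc (count P) ≤ count S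
count-strict P S i P⊆S Si Pi = begin
  suc (count P)              ≡⟨ +-comm 1 (count P) ⟩
  count P + 1                ≡⟨ count-insert P i Pi ⟨
  count (P ∪ᵇ ｛ i ｝)        ≤⟨ count-mono P∪i⊆S ⟩
  count S                    ∎
  where
  open ≤-Reasoning
  P∪i⊆S : (P ∪ᵇ ｛ i ｝) ⊆ᵇ S
  P∪i⊆S j e with j ≟ i | P j in Pj
  ... | yes refl | _ = Si
  ... | no _ | true = P⊆S j Pj
  P∪i⊆S j () | no _ | false

member-of : ∀ {n} (S : Subsetᵇ n) → 1 ≤ count S → Σ (Fin n) λ i → S i ≡ true
member-of {suc n} S c with S fzero in S0
... | true = fzero , S0
... | false with member-of (λ i → S (fsuc i)) c
...   | i , Si = fsuc i , Si

nonmember-of : ∀ {n} (S : Subsetᵇ n) → count S < n → Σ (Fin n) λ i → S i ≡ false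
nonmember-of {suc n} S c with S fzero in S0
... | false = fzero , S0
... | true with nonmember-of (λ i → S (fsuc i)) (≤-pred c)
...   | i , Si = fsuc i , Si

-- capacity x t = Σᵢ min(xᵢ, t): the number of cells of x lying in the
-- lowest t levels.
capacity : ∀ {n} → Position n → ℕ → ℕ
capacity x t = sum (λ i → x i ⊓ t)

-- t rounds of l unit decrements fit into x.  This is the quantity that
-- controls the Tetris value when the smallest hyperedges have size l.
Feasible : ∀ {n} → ℕ → Position n → ℕ → Set
Feasible l x t = l * t ≤ capacity x t

feasible-zero : ∀ {n} l (x : Position n) → Feasible l x 0
feasible-zero l x = ≤-trans (≤-reflexive (*-zeroʳ l)) z≤n

feasible? : ∀ {n} l (x : Position n) t → Dec (Feasible l x t)
feasible? l x t = l * t ≤? capacity x t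

lowerOn : ∀ {n} → Subsetᵇ n → Position n → Position n
lowerOn D x i = if D i then x i ∸ 1 else x i

clearOn : ∀ {n} → Subsetᵇ n → Position n → Position n
clearOn S x i = if S i then 0 else x i

above : ∀ {n} → ℕ → Position n → Subsetᵇ n
above t x i = ⌊ suc t ≤? x i ⌋

support : ∀ {n} → Position n → Subsetᵇ n
support x = above 0 x

aboveOutside : ∀ {n} → Subsetᵇ n → ℕ → Position n → Subsetᵇ n
aboveOutside D t x i = not (D i) ∧ above t x i

aboveOutside-split : ∀ {n} (D : Subsetᵇ n) t (x : Position n) j → aboveOutside D t x j ≡ true →
  D j ≡ false × above t x j ≡ true
aboveOutside-split D t x j out with D j | above t x j
aboveOutside-split D t x j () | true | _
aboveOutside-split D t x j () | false | false
aboveOutside-split D t x j _ | false | true = refl , refl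

_≤ᵖ_ : ∀ {n} → Position n → Position n → Set
x ≤ᵖ y = ∀ i → x i ≤ y i

clearOn-≤ : ∀ {n} (S : Subsetᵇ n) (x : Position n) → clearOn S x ≤ᵖ x
clearOn-≤ S x i with S i
... | true = z≤n
... | false = ≤-refl

clearOn-outside : ∀ {n} (S : Subsetᵇ n) (x : Position n) i → S i ≡ false → clearOn S x i ≡ x i
clearOn-outside S x i Si rewrite Si = refl

clearOn-inside : ∀ {n} (S : Subsetᵇ n) (x : Position n) i → S i ≡ true → clearOn S x i ≡ 0
clearOn-inside S x i Si rewrite Si = refl

lowerOn-inside : ∀ {n} (D : Subsetᵇ n) (x : Position n) i → D i ≡ true → lowerOn D x i ≡ x i ∸ 1
lowerOn-inside D x i Di rewrite Di = refl

lowerOn-≥ : ∀ {n} (D : Subsetᵇ n) (x : Position n) i → x i ∸ 1 ≤ lowerOn D x i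
lowerOn-≥ D x i with D i
... | true = ≤-refl
... | false = m∸n≤m (x i) 1

<⇒≤∸1 : ∀ {a b} → a < b → a ≤ b ∸ 1
<⇒≤∸1 (s≤s a≤b) = a≤b

lowerOn-≤ : ∀ {n} (D : Subsetᵇ n) (x : Position n) → lowerOn D x ≤ᵖ x
lowerOn-≤ D x i with D i
... | true = m∸n≤m (x i) 1
... | false = ≤-refl

lowerOn-< : ∀ {n} (D : Subsetᵇ n) (x : Position n) i → D i ≡ true → support x i ≡ true → lowerOn D x i < x i
lowerOn-< D x i Di positive rewrite Di with x i | witness (1 ≤? x i) positive
... | suc a | _ = ≤-refl

lowerOn-outside : ∀ {n} (D : Subsetᵇ n) (x : Position n) i → D i ≡ false → lowerOn D x i ≡ x i
lowerOn-outside D x i Di rewrite Di = refl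

aboveOutside⊆above : ∀ {n} (D : Subsetᵇ n) t (x : Position n) → aboveOutside D t x ⊆ᵇ above t x
aboveOutside⊆above D t x i e with D i
... | false = e

sum-lowerOn : ∀ {n} (D : Subsetᵇ n) (x : Position n) → D ⊆ᵇ support x → sum (lowerOn D x) + count D ≡ sum x
sum-lowerOn D x D⊆supp =
  trans (sym (∑-distrib-+ (lowerOn D x) (λ i → 𝟙 (D i)))) (sum-cong-≗ restore)
  where
  restore : ∀ i → lowerOn D x i + 𝟙 (D i) ≡ x i
  restore i with D i in Di
  ... | true = m∸n+n≡m (witness (1 ≤? x i) (D⊆supp i Di))
  ... | false = +-identityʳ (x i)

⊓-suc : ∀ a t → a ⊓ suc t ≡ a ⊓ t + 𝟙 ⌊ suc t ≤? a ⌋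
⊓-suc a t with suc t ≤? a
... | yes t<a = begin
  a ⊓ suc t      ≡⟨ m≥n⇒m⊓n≡n t<a ⟩
  suc t          ≡⟨ +-comm 1 t ⟩
  t + 1          ≡⟨ cong (_+ 1) (m≥n⇒m⊓n≡n (<⇒≤ t<a)) ⟨
  a ⊓ t + 1      ∎
  where open ≡-Reasoning
... | no t≮a = begin
  a ⊓ suc t      ≡⟨ m≤n⇒m⊓n≡m (m≤n⇒m≤1+n a≤t) ⟩
  a              ≡⟨ m≤n⇒m⊓n≡m a≤t ⟨
  a ⊓ t          ≡⟨ +-identityʳ (a ⊓ t) ⟨
  a ⊓ t + 0      ∎
  where
  open ≡-Reasoning
  a≤t = ≮⇒≥ t≮a

capacity-lower : ∀ {n} (D : Subsetᵇ n) (x : Position n) t → D ⊆ᵇ support x →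
  capacity x (suc t) ≡ capacity (lowerOn D x) t + (count D + count (aboveOutside D t x))
capacity-lower D x t D⊆supp = begin
  capacity x (suc t)
    ≡⟨ sum-cong-≗ pointwise ⟩
  sum (λ i → lowerOn D x i ⊓ t + (𝟙 (D i) + 𝟙 (aboveOutside D t x i)))
    ≡⟨ ∑-distrib-+ (λ i → lowerOn D x i ⊓ t) _ ⟩
  capacity (lowerOn D x) t + sum (λ i → 𝟙 (D i) + 𝟙 (aboveOutside D t x i))
    ≡⟨ cong (capacity (lowerOn D x) t +_) (∑-distrib-+ (λ i → 𝟙 (D i)) _) ⟩
  capacity (lowerOn D x) t + (count D + count (aboveOutside D t x)) ∎
  where
  open ≡-Reasoning
  pointwise : ∀ i → x i ⊓ suc t ≡ lowerOn D x i ⊓ t + (𝟙 (D i) + 𝟙 (aboveOutside D t x i))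
  pointwise i with D i in Di
  ... | false = ⊓-suc (x i) t
  ... | true with x i | D⊆supp i Di
  ...   | suc a | _ = +-comm 1 (a ⊓ t)

tall⇒feasible : ∀ {n} l (x : Position n) t (R : Subsetᵇ n) → l ≤ count R → (∀ i → R i ≡ true → t ≤ x i) →
  Feasible l x t
tall⇒feasible l x t R l≤R tall = begin
  l * t                           ≡⟨ *-comm l t ⟩
  t * l                           ≤⟨ *-monoʳ-≤ t l≤R ⟩
  t * count R                     ≡⟨ *-distribˡ-sum t (λ i → 𝟙 (R i)) ⟩
  sum (λ i → t * 𝟙 (R i))         ≤⟨ sum-mono full ⟩
  capacity x t                    ∎
  where
  open ≤-Reasoning
  full : ∀ i → t * 𝟙 (R i) ≤ x i ⊓ t
  full i with R i in Ri
  ... | false = ≤-trans (≤-reflexive (*-zeroʳ t)) z≤n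
  ... | true = ≤-reflexive (trans (*-identityʳ t) (sym (m≥n⇒m⊓n≡n (tall i Ri))))

-- If x vanishes outside a set U of at most l coordinates, one of which is
-- at most z, then z+1 rounds are not feasible: one cell is missing.
sparse⇒infeasible : ∀ {n} l (x : Position n) z (U : Subsetᵇ n) → count U ≤ l →
  (∀ i → U i ≡ false → x i ≡ 0) → ∀ j → U j ≡ true → x j ≤ z → ¬ Feasible l x (suc z)
sparse⇒infeasible l x z U U≤l vanish j Uj xj≤z feasible = <-irrefl refl (begin-strict
  l * suc z                                         ≤⟨ feasible ⟩
  capacity x (suc z)                                <⟨ m<m+n _ (s≤s z≤n) ⟩
  capacity x (suc z) + 1                            ≡⟨ cong (capacity x (suc z) +_) (count-singleton j) ⟨
  capacity x (suc z) + count ｛ j ｝                  ≡⟨ ∑-distrib-+ (λ i → x i ⊓ suc z) (λ i → 𝟙 (｛ j ｝ i)) ⟨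
  sum (λ i → x i ⊓ suc z + 𝟙 (｛ j ｝ i))             ≤⟨ sum-mono bounded ⟩
  sum (λ i → suc z * 𝟙 (U i))                       ≡⟨ *-distribˡ-sum (suc z) (λ i → 𝟙 (U i)) ⟨
  suc z * count U                                   ≤⟨ *-monoʳ-≤ (suc z) U≤l ⟩
  suc z * l                                         ≡⟨ *-comm (suc z) l ⟩
  l * suc z                                         ∎)
  where
  open ≤-Reasoning
  bounded : ∀ i → x i ⊓ suc z + 𝟙 (｛ j ｝ i) ≤ suc z * 𝟙 (U i)
  bounded i with i ≟ j
  ... | yes refl rewrite Uj | *-identityʳ (suc z) = ≤-trans (≤-reflexive (+-comm _ 1)) (s≤s (≤-trans (m⊓n≤m (x j) (suc z)) xj≤z))
  ... | no _ with U i in Ui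
  ...   | true rewrite *-identityʳ (suc z) | +-identityʳ (x i ⊓ suc z) = m⊓n≤n (x i) (suc z)
  ...   | false rewrite vanish i Ui | *-zeroʳ (suc z) = ≤-refl

-- One round can be peeled off a feasible position by lowering a set D of
-- positive coordinates, provided either D together with the coordinates
-- above t outside it has at most l elements, or at least l coordinates
-- lie above t (then the lowest t levels are full on l coordinates).
feasible-peel : ∀ {n} l (D : Subsetᵇ n) (x : Position n) t → D ⊆ᵇ support x →
  (count D + count (aboveOutside D t x) ≤ l ⊎ l ≤ count (above t x)) →
  Feasible l x (suc t) → Feasible l (lowerOn D x) t
feasible-peel l D x t D⊆supp (inj₁ lost≤l) feasible = +-cancelˡ-≤ l _ _ (begin
  l + l * t                                   ≡⟨ *-suc l t ⟨
  l * suc t                                   ≤⟨ feasible ⟩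
  capacity x (suc t)                          ≡⟨ capacity-lower D x t D⊆supp ⟩
  capacity (lowerOn D x) t + (count D + _)    ≤⟨ +-monoʳ-≤ (capacity (lowerOn D x) t) lost≤l ⟩
  capacity (lowerOn D x) t + l                ≡⟨ +-comm _ l ⟩
  l + capacity (lowerOn D x) t                ∎)
  where open ≤-Reasoning
feasible-peel l D x t _ (inj₂ l≤above) _ = tall⇒feasible l (lowerOn D x) t (above t x) l≤above tall
  where
  tall : ∀ i → above t x i ≡ true → t ≤ lowerOn D x i
  tall i e with D i | witness (suc t ≤? x i) e
  ... | true | t<xi = <⇒≤∸1 t<xi
  ... | false | t<xi = <⇒≤ t<xi

count-peel-within : ∀ {n} (D : Subsetᵇ n) t (x : Position n) → D ⊆ᵇ above t x →
  count D + count (aboveOutside D t x) ≤ count (above t x)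
count-peel-within D t x D⊆above = begin
  count D + count (aboveOutside D t x)            ≡⟨ ∑-distrib-+ (λ i → 𝟙 (D i)) _ ⟨
  sum (λ i → 𝟙 (D i) + 𝟙 (aboveOutside D t x i))  ≤⟨ sum-mono pointwise ⟩
  count (above t x)                               ∎
  where
  open ≤-Reasoning
  pointwise : ∀ i → 𝟙 (D i) + 𝟙 (aboveOutside D t x i) ≤ 𝟙 (above t x i)
  pointwise i with D i in Di
  ... | true rewrite D⊆above i Di = ≤-refl
  ... | false = ≤-refl

peel-condition : ∀ {n} l (D : Subsetᵇ n) t (x : Position n) → count D ≤ l →
  (∀ j → aboveOutside D t x j ≡ true → l ≤ count (above t x) ⊎ D ⊆ᵇ above t x) →
  count D + count (aboveOutside D t x) ≤ l ⊎ l ≤ count (above t x)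
peel-condition l D t x D≤l spill with l ≤? count (above t x)
... | yes many = inj₂ many
... | no few with any? (λ j → aboveOutside D t x j ≟ᵇ true)
...   | no none = inj₁ (≤-trans (≤-reflexive (trans (cong (count D +_) (count-none _ nothing)) (+-identityʳ _))) D≤l)
  where
  nothing : ∀ j → aboveOutside D t x j ≡ false
  nothing j with aboveOutside D t x j in e
  ... | true = ⊥-elim (none (j , e))
  ... | false = refl
...   | yes (j , outside) with spill j outside
...     | inj₁ many = ⊥-elim (few many)
...     | inj₂ D⊆above = inj₁ (≤-trans (count-peel-within D t x D⊆above) (<⇒≤ (≰⇒> few)))

feasible-mono : ∀ {n} l {x y : Position n} t → x ≤ᵖ y → Feasible l x t → Feasible l y t
feasible-mono l t x≤y feasible = ≤-trans feasible (sum-mono (λ i → ⊓-monoˡ-≤ t (x≤y i)))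

feasible-pred : ∀ {n} l (x : Position n) t → Feasible l x (suc t) → Feasible l x t
feasible-pred {n} l x t feasible with l ≤? count (above t x)
... | yes many = feasible-peel l ∅ᵇ x t (λ _ ()) (inj₂ many) feasible
... | no few = feasible-peel l ∅ᵇ x t (λ _ ()) (inj₁ lost≤l) feasible
  where
  lost≤l : count (∅ᵇ {n}) + count (aboveOutside ∅ᵇ t x) ≤ l
  lost≤l rewrite count-empty {n} = <⇒≤ (≰⇒> few)

feasible-≤ : ∀ {n} l (x : Position n) {s t} → s ≤ t → Feasible l x t → Feasible l x s
feasible-≤ l x {s} s≤t =
  propagate (λ t → Feasible l x t → Feasible l x s) (λ t down fits → down (feasible-pred l x t fits)) s≤t (λ fits → fits)

-- A position with p positive coordinates has capacity at most t·p, so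
-- feasibility of a positive number of rounds forces p ≥ l.
feasible⇒support : ∀ {n} l (x : Position n) t → Feasible l x (suc t) → l ≤ count (support x)
feasible⇒support l x t feasible = *-cancelʳ-≤ l (count (support x)) (suc t) (begin
  l * suc t                               ≤⟨ feasible ⟩
  capacity x (suc t)                      ≤⟨ sum-mono bounded ⟩
  sum (λ i → suc t * 𝟙 (support x i))     ≡⟨ *-distribˡ-sum (suc t) (λ i → 𝟙 (support x i)) ⟨
  suc t * count (support x)               ≡⟨ *-comm (suc t) _ ⟩
  count (support x) * suc t               ∎)
  where
  open ≤-Reasoning
  bounded : ∀ i → x i ⊓ suc t ≤ suc t * 𝟙 (support x i)
  bounded i with x i
  ... | zero = z≤n
  ... | suc a = ≤-trans (m⊓n≤n (suc a) (suc t)) (≤-reflexive (sym (*-identityʳ (suc t))))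

_◂_ : ∀ {n} → Bool → Subsetᵇ n → Subsetᵇ (suc n)
(b ◂ S) fzero = b
(b ◂ S) (fsuc i) = S i

⊆-by-cases : ∀ {n} {S T : Subsetᵇ (suc n)} → (S fzero ≡ true → T fzero ≡ true) →
             (λ i → S (fsuc i)) ⊆ᵇ (λ i → T (fsuc i)) → S ⊆ᵇ T
⊆-by-cases head _ fzero = head
⊆-by-cases _ tail (fsuc i) = tail i

choose : ∀ {n} (P Q : Subsetᵇ n) l → P ⊆ᵇ Q → count P ≤ l → l ≤ count Q →
         Σ (Subsetᵇ n) λ S → P ⊆ᵇ S × S ⊆ᵇ Q × count S ≡ l
choose {zero} P Q zero _ _ _ = ∅ᵇ , (λ ()) , (λ ()) , refl
choose {suc n} P Q l P⊆Q P≤l l≤Q with P fzero in P0 | Q fzero in Q0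
... | true | false with () ← trans (sym (P⊆Q fzero P0)) Q0
... | true | true with l | P≤l
...   | suc l' | s≤s P'≤l'
      with S , P'⊆S , S⊆Q' , |S| ← choose (λ i → P (fsuc i)) (λ i → Q (fsuc i)) l' (λ i → P⊆Q (fsuc i)) P'≤l' (≤-pred l≤Q)
      = true ◂ S , ⊆-by-cases (λ _ → refl) P'⊆S , ⊆-by-cases (λ _ → Q0) S⊆Q' , cong suc |S|
choose {suc n} P Q l P⊆Q P≤l l≤Q | false | q0 with l ≤? count (λ i → Q (fsuc i))
... | yes l≤Q'
    with S , P'⊆S , S⊆Q' , |S| ← choose (λ i → P (fsuc i)) (λ i → Q (fsuc i)) l (λ i → P⊆Q (fsuc i)) P≤l l≤Q'
    = false ◂ S , ⊆-by-cases (λ e → ⊥-elim (false≢true (trans (sym P0) e))) P'⊆S , ⊆-by-cases (λ ()) S⊆Q' , |S|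
... | no l≰Q' with q0 | l | l≤Q
...   | false | _ | l≤Q' = ⊥-elim (l≰Q' l≤Q')
...   | true | zero | _ = ⊥-elim (l≰Q' z≤n)
...   | true | suc l' | s≤s l'≤Q'
      with S , P'⊆S , S⊆Q' , |S| ← choose (λ i → P (fsuc i)) (λ i → Q (fsuc i)) l' (λ i → P⊆Q (fsuc i))
               (≤-pred (≤-trans (s≤s (count-mono (λ i → P⊆Q (fsuc i)))) (≰⇒> l≰Q'))) l'≤Q'
      = true ◂ S , ⊆-by-cases (λ _ → refl) P'⊆S , ⊆-by-cases (λ _ → Q0) S⊆Q' , cong suc |S|

∣tabulate∣ : ∀ {n} (S : Subsetᵇ n) → ∣ tabulate S ∣ ≡ count S
∣tabulate∣ {zero} S = refl
∣tabulate∣ {suc n} S with S fzero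
... | true = cong suc (∣tabulate∣ (λ i → S (fsuc i)))
... | false = ∣tabulate∣ (λ i → S (fsuc i))

∣lookup∣ : ∀ {n} (H : Subset n) → ∣ H ∣ ≡ count (lookup H)
∣lookup∣ [] = refl
∣lookup∣ (true ∷ H) = cong suc (∣lookup∣ H)
∣lookup∣ (false ∷ H) = ∣lookup∣ H

moveOn : ∀ {n} {𝓗 : Hypergraph n} (S : Subsetᵇ n) {x x' : Position n} → 𝓗 (tabulate S) →
         (∀ i → S i ≡ true → x' i < x i) → (∀ i → S i ≡ false → x' i ≡ x i) → Move 𝓗 x x'
moveOn S edge inside outside = tabulate S , edge , λ i → inS i , outS i
  where
  inS : ∀ i → i ∈ tabulate S → _
  inS i i∈S = inside i (trans (sym (lookup∘tabulate S i)) ([]=⇒lookup i∈S))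
  outS : ∀ i → i ∉ tabulate S → _
  outS i i∉S with S i in Si
  ... | true = ⊥-elim (i∉S (lookup⇒[]= i (tabulate S) (trans (lookup∘tabulate S i) Si)))
  ... | false = outside i Si

squeeze-move : ∀ {n} {𝓗 : Hypergraph n} (S : Subsetᵇ n) {x c : Position n} → 𝓗 (tabulate S) →
  S ⊆ᵇ support x → c ≤ᵖ lowerOn S x → (∀ i → S i ≡ false → x i ≤ c i) → Move 𝓗 x c
squeeze-move S {x} edge S⊆supp c≤ ≤c = moveOn S edge
  (λ i Si → ≤-trans (s≤s (c≤ i)) (lowerOn-< S x i Si (S⊆supp i Si)))
  (λ i Si → ≤-antisym (≤-trans (c≤ i) (≤-reflexive (lowerOn-outside S x i Si))) (≤c i Si))

ValueIs : ∀ {n} → ℕ → Position n → ℕ → Set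
ValueIs l x z = Feasible l x z × ¬ Feasible l x (suc z)

-- If every hyperedge has at least l vertices, a play of length t fits l·t
-- cells into the lowest t levels: each move takes at least l cells.
play⇒feasible : ∀ {n} (𝓗 : Hypergraph n) l → (∀ H → 𝓗 H → l ≤ ∣ H ∣) →
                ∀ {x t} → Play 𝓗 x t → Feasible l x t
play⇒feasible 𝓗 l large {x} stop = feasible-zero l x
play⇒feasible 𝓗 l large {x} {suc t} (step {x' = x'} (H , edge , move) rest) = begin
  l * suc t                                       ≡⟨ *-suc l t ⟩
  l + l * t                                       ≤⟨ +-mono-≤ (≤-trans (large H edge) (≤-reflexive (∣lookup∣ H)))
                                                                (play⇒feasible 𝓗 l large rest) ⟩
  count (lookup H) + capacity x' t                ≡⟨ +-comm _ (capacity x' t) ⟩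
  capacity x' t + count (lookup H)                ≡⟨ ∑-distrib-+ (λ i → x' i ⊓ t) (λ i → 𝟙 (lookup H i)) ⟨
  sum (λ i → x' i ⊓ t + 𝟙 (lookup H i))           ≤⟨ sum-mono cellwise ⟩
  capacity x (suc t)                              ∎
  where
  open ≤-Reasoning
  cellwise : ∀ i → x' i ⊓ t + 𝟙 (lookup H i) ≤ x i ⊓ suc t
  cellwise i with lookup H i in Hi
  ... | true = ≤-trans (≤-reflexive (+-comm _ 1)) (⊓-monoˡ-≤ (suc t) (proj₁ (move i) (lookup⇒[]= i H Hi)))
  ... | false rewrite proj₂ (move i) (λ i∈H → false≢true (trans (sym Hi) ([]=⇒lookup i∈H))) =
    ≤-trans (≤-reflexive (+-identityʳ _)) (⊓-monoʳ-≤ (x i) (n≤1+n t))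

-- Conversely, if all l-sets are hyperedges, a feasible round can always be
-- played: lower l coordinates above t if there are that many, and otherwise
-- all coordinates above t together with further positive ones.
feasible⇒play : ∀ {n} (𝓗 : Hypergraph n) l → (∀ S → count S ≡ l → 𝓗 (tabulate S)) →
                ∀ t (x : Position n) → Feasible l x t → Play 𝓗 x t
feasible⇒play 𝓗 l edges zero x _ = stop
feasible⇒play {n} 𝓗 l edges (suc t) x feasible = go (l ≤? count (above t x))
  where
  round : ∀ S → count S ≡ l → S ⊆ᵇ support x →
          (count S + count (aboveOutside S t x) ≤ l ⊎ l ≤ count (above t x)) → Play 𝓗 x (suc t)
  round S |S| S⊆supp condition =
    step (moveOn S (edges S |S|) (λ i Si → lowerOn-< S x i Si (S⊆supp i Si)) (lowerOn-outside S x))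
         (feasible⇒play 𝓗 l edges t (lowerOn S x) (feasible-peel l S x t S⊆supp condition feasible))

  above⊆support : above t x ⊆ᵇ support x
  above⊆support i e = confirm (1 ≤? x i) (≤-trans (s≤s z≤n) (witness (suc t ≤? x i) e))

  go : Dec (l ≤ count (above t x)) → Play 𝓗 x (suc t)
  go (yes many) with S , _ , S⊆above , |S| ← choose ∅ᵇ (above t x) l (λ _ ()) (≤-trans (≤-reflexive (count-empty {n})) z≤n) many
    = round S |S| (λ i Si → above⊆support i (S⊆above i Si)) (inj₂ many)
  go (no few) with S , above⊆S , S⊆supp , |S| ← choose (above t x) (support x) l above⊆support
                                                    (<⇒≤ (≰⇒> few)) (feasible⇒support l x t feasible)
    = round S |S| S⊆supp (inj₁ (≤-reflexive (trans (cong (count S +_) (count-none _ nothingOutside)) (trans (+-identityʳ _) |S|))))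
    where
    nothingOutside : ∀ i → aboveOutside S t x i ≡ false
    nothingOutside i with above t x i in Ai
    ... | false = ∧-zeroʳ (not (S i))
    ... | true rewrite above⊆S i Ai = refl

minPos-≤ : ∀ {n} (x : Position n) i → minPos x ≤ x i
minPos-≤ {suc zero} x fzero = ≤-refl
minPos-≤ {suc (suc n)} x fzero = m⊓n≤m _ _
minPos-≤ {suc (suc n)} x (fsuc i) = ≤-trans (m⊓n≤n _ _) (minPos-≤ (λ j → x (fsuc j)) i)

minPos-attained : ∀ {n} (x : Position (suc n)) → Σ (Fin (suc n)) λ i → x i ≡ minPos x
minPos-attained {zero} x = fzero , refl
minPos-attained {suc n} x with x fzero ≤? minPos (λ j → x (fsuc j))
... | yes x₀≤ = fzero , sym (m≤n⇒m⊓n≡m x₀≤)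
... | no x₀≰ with i , xᵢ≡ ← minPos-attained (λ j → x (fsuc j))
    = fsuc i , trans xᵢ≡ (sym (m≥n⇒m⊓n≡n (<⇒≤ (≰⇒> x₀≰))))

C-mono : ∀ k {m n} → m ≤ n → m C suc k ≤ n C suc k
C-mono k {m} m≤n = propagate (λ j → m C suc k ≤ j C suc k) grow m≤n ≤-refl
  where
  grow : ∀ j → m C suc k ≤ j C suc k → m C suc k ≤ suc j C suc k
  grow j m≤j = begin
    m C suc k                    ≤⟨ m≤j ⟩
    j C suc k                    ≤⟨ m≤n+m _ (j C k) ⟩
    j C k + j C suc k            ≡⟨ nCk+nC[k+1]≡[n+1]C[k+1] j k ⟩
    suc j C suc k                ∎
    where open ≤-Reasoning

-- For a hypergraph whose hyperedges have at least l ≥ 1 vertices and which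
-- contains every l-set, the Tetris value is the value of the position:
-- the largest number of feasible rounds.
module Tetris {n} (𝓗 : Hypergraph n) (l : ℕ) (l≥1 : 1 ≤ l)
  (large : ∀ H → 𝓗 H → l ≤ ∣ H ∣) (edges : ∀ S → count S ≡ l → 𝓗 (tabulate S)) where

  value⇒tetris : ∀ {x : Position n} {z} → ValueIs l x z → IsTetris 𝓗 x z
  value⇒tetris {x} {z} (feasible , infeasible) = feasible⇒play 𝓗 l edges z x feasible , longest
    where
    longest : ∀ s → Play 𝓗 x s → s ≤ z
    longest s play with s ≤? z
    ... | yes s≤z = s≤z
    ... | no s≰z = ⊥-elim (infeasible (feasible-≤ l x (≰⇒> s≰z) (play⇒feasible 𝓗 l large play)))

  tetris-feasible : ∀ {x : Position n} {t} → IsTetris 𝓗 x t → Feasible l x t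
  tetris-feasible (play , _) = play⇒feasible 𝓗 l large play

  below-tetris : ∀ {x : Position n} {T} z → IsTetris 𝓗 x T → z < T → Feasible l x (suc z)
  below-tetris {x} z tetris z<T = feasible-≤ l x z<T (tetris-feasible tetris)

  tetris-mono : ∀ {x y : Position n} {s t} → x ≤ᵖ y → IsTetris 𝓗 x s → IsTetris 𝓗 y t → s ≤ t
  tetris-mono x≤y (play , _) (_ , longest) =
    longest _ (feasible⇒play 𝓗 l edges _ _ (feasible-mono l _ x≤y (play⇒feasible 𝓗 l large play)))

  -- More than Σᵢ xᵢ rounds never fit, so searching downwards finds the value.
  tetris-exists : ∀ (x : Position n) → Σ ℕ (IsTetris 𝓗 x)
  tetris-exists x = map₂ value⇒tetris (lastFeasible (suc (sum x)) tooMany)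
    where
    lastFeasible : ∀ N → ¬ Feasible l x N → Σ ℕ (ValueIs l x)
    lastFeasible zero infeasible = ⊥-elim (infeasible (feasible-zero l x))
    lastFeasible (suc N) infeasible with feasible? l x N
    ... | yes feasible = N , feasible , infeasible
    ... | no infeasible' = lastFeasible N infeasible'

    tooMany : ¬ Feasible l x (suc (sum x))
    tooMany feasible = <-irrefl refl (begin-strict
      sum x                       <⟨ n<1+n (sum x) ⟩
      suc (sum x)                 ≡⟨ *-identityˡ _ ⟨
      1 * suc (sum x)             ≤⟨ *-monoˡ-≤ (suc (sum x)) l≥1 ⟩
      l * suc (sum x)             ≤⟨ feasible ⟩
      capacity x (suc (sum x))    ≤⟨ sum-mono (λ i → m⊓n≤m (x i) _) ⟩
      sum x                       ∎)
      where open ≤-Reasoning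

  long-of-zero : ∀ (c : Position n) i → c i ≡ 0 → Long 𝓗 c
  long-of-zero c i cᵢ≡0 with t , tetris ← tetris-exists (reduce c) =
    t , tetris , ≤-trans (≤-trans (minPos-≤ c i) (≤-reflexive cᵢ≡0)) z≤n

  long-transfer : ∀ {x c : Position n} → Long 𝓗 x → minPos c ≤ minPos x → reduce x ≤ᵖ reduce c → Long 𝓗 c
  long-transfer {c = c} (t , tetris , long) min≤ reduce≤ with t' , tetris' ← tetris-exists (reduce c) =
    t' , tetris' , ≤-trans min≤ (≤-trans long (C-mono 1 (s≤s (tetris-mono reduce≤ tetris tetris'))))

-- Going from b down to a one unit at
-- a time, the value drops by at most one per step (a feasible round can be
-- peeled off by lowering one coordinate), so if a is below z+1 rounds and b
-- reaches z rounds, some position in between has value exactly z.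
intermediate-value : ∀ {n} l (a b : Position n) z → a ≤ᵖ b →
  ¬ Feasible l a (suc z) → Feasible l b z →
  Σ (Position n) λ c → a ≤ᵖ c × c ≤ᵖ b × ValueIs l c z
intermediate-value {n} l a b z = descend (sum b) b ≤-refl
  where
  descend : ∀ N b → sum b ≤ N → a ≤ᵖ b → ¬ Feasible l a (suc z) → Feasible l b z →
            Σ (Position n) λ c → a ≤ᵖ c × c ≤ᵖ b × ValueIs l c z
  descend N b b≤N a≤b a-low b-high with feasible? l b (suc z)
  ... | no b-exact = b , a≤b , (λ _ → ≤-refl) , b-high , b-exact
  ... | yes b-higher with any? (λ i → a i <? b i)
  ...   | no a≥b = ⊥-elim (a-low (feasible-mono l (suc z) (λ i → ≮⇒≥ (λ a<b → a≥b (i , a<b))) b-higher))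
  ...   | yes (i , aᵢ<bᵢ) = recurse N b≤N
    where
    i⊆supp : ｛ i ｝ ⊆ᵇ support b
    i⊆supp j e with j ≟ i
    ... | yes refl = confirm (1 ≤? b i) (≤-trans (s≤s z≤n) aᵢ<bᵢ)

    b' = lowerOn ｛ i ｝ b

    a≤b' : a ≤ᵖ b'
    a≤b' j with j ≟ i
    ... | yes refl = <⇒≤∸1 aᵢ<bᵢ
    ... | no _ = a≤b j

    b'≤b : b' ≤ᵖ b
    b'≤b = lowerOn-≤ ｛ i ｝ b

    b'-high : Feasible l b' z
    b'-high with l ≤? count (above z b)
    ... | yes many = feasible-peel l ｛ i ｝ b z i⊆supp (inj₂ many) b-higher
    ... | no few = feasible-peel l ｛ i ｝ b z i⊆supp (inj₁ (begin
      count ｛ i ｝ + count (aboveOutside ｛ i ｝ z b)   ≤⟨ +-mono-≤ (≤-reflexive (count-singleton i))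
                                                            (count-mono (aboveOutside⊆above ｛ i ｝ z b)) ⟩
      suc (count (above z b))                          ≤⟨ ≰⇒> few ⟩
      l                                                ∎)) b-higher
      where open ≤-Reasoning

    smaller : suc (sum b') ≡ sum b
    smaller = trans (+-comm 1 _) (trans (cong (sum b' +_) (sym (count-singleton i))) (sum-lowerOn ｛ i ｝ b i⊆supp))

    recurse : ∀ N → sum b ≤ N → Σ (Position n) λ c → a ≤ᵖ c × c ≤ᵖ b × ValueIs l c z
    recurse zero b≤0 with () ← ≤-trans (≤-reflexive smaller) b≤0
    recurse (suc N) b≤N with c , a≤c , c≤b' , value ← descend N b' (≤-pred (≤-trans (≤-reflexive smaller) b≤N)) a≤b' a-low b'-high
      = c , a≤c , (λ j → ≤-trans (c≤b' j) (b'≤b j)) , value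

data MaxOutside {n} (S : Subsetᵇ n) (y : Position n) : Set where
  full  : (∀ j → S j ≡ true) → MaxOutside S y
  maxAt : (i : Fin n) → S i ≡ false → (∀ j → S j ≡ false → y j ≤ y i) → MaxOutside S y

maxOutside : ∀ {n} (S : Subsetᵇ n) (y : Position n) → MaxOutside S y
maxOutside {zero} S y = full (λ ())
maxOutside {suc n} S y with maxOutside (λ i → S (fsuc i)) (λ i → y (fsuc i)) | S fzero in S0
... | full rest | true = full λ { fzero → S0 ; (fsuc j) → rest j }
... | full rest | false = maxAt fzero S0 λ { fzero _ → ≤-refl ; (fsuc j) Sj → ⊥-elim (false≢true (trans (sym Sj) (rest j))) }
... | maxAt i Si max | true = maxAt (fsuc i) Si λ { fzero Sj → ⊥-elim (false≢true (trans (sym Sj) S0)) ; (fsuc j) Sj → max j Sj }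
... | maxAt i Si max | false with y fzero ≤? y (fsuc i)
...   | yes y₀≤yᵢ = maxAt (fsuc i) Si λ { fzero _ → y₀≤yᵢ ; (fsuc j) Sj → max j Sj }
...   | no y₀≰yᵢ = maxAt fzero S0 λ { fzero _ → ≤-refl ; (fsuc j) Sj → ≤-trans (max j Sj) (<⇒≤ (≰⇒> y₀≰yᵢ)) }

extend : ∀ {n} {S : Subsetᵇ n} {y : Position n} → MaxOutside S y → Subsetᵇ n
extend {S = S} (full _) = S
extend {S = S} (maxAt i _ _) = S ∪ᵇ ｛ i ｝

heaviest : ∀ {n} → Position n → ℕ → Subsetᵇ n
heaviest y zero = ∅ᵇ
heaviest y (suc h) = extend (maxOutside (heaviest y h) y)

heaviest-⊆ : ∀ {n} (y : Position n) {h h'} → h ≤ h' → heaviest y h ⊆ᵇ heaviest y h'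
heaviest-⊆ y h≤h' i = propagate (λ h → heaviest y h i ≡ true) grow h≤h'
  where
  grow : ∀ h → heaviest y h i ≡ true → heaviest y (suc h) i ≡ true
  grow h i∈ with maxOutside (heaviest y h) y
  ... | full _ = i∈
  ... | maxAt _ _ _ rewrite i∈ = refl

heaviest-dominates : ∀ {n} (y : Position n) h i j → heaviest y h i ≡ true → heaviest y h j ≡ false → y j ≤ y i
heaviest-dominates y (suc h) i j i∈ j∉ with maxOutside (heaviest y h) y
... | full _ = heaviest-dominates y h i j i∈ j∉
... | maxAt m _ max with heaviest y h i in Hi | i ≟ m
...   | true | _ = heaviest-dominates y h i j Hi (∨-conicalˡ _ _ j∉)
...   | false | yes refl = max j (∨-conicalˡ _ _ j∉)
...   | false | no _ = ⊥-elim (false≢true i∈)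

count-heaviest : ∀ {n} (y : Position n) h → h ≤ n → count (heaviest y h) ≡ h
count-heaviest {n} y zero _ = count-empty {n}
count-heaviest {n} y (suc h) h<n with maxOutside (heaviest y h) y
... | full all = ⊥-elim (<-irrefl refl (begin-strict
  h                         <⟨ h<n ⟩
  n                         ≡⟨ count-all (heaviest y h) all ⟨
  count (heaviest y h)      ≡⟨ count-heaviest y h (<⇒≤ h<n) ⟩
  h                         ∎))
  where open ≤-Reasoning
... | maxAt m m∉ _ = trans (count-insert (heaviest y h) m m∉) (trans (cong (_+ 1) (count-heaviest y h (<⇒≤ h<n))) (+-comm h 1))

heaviest⊆support : ∀ {n} (y : Position n) h → h ≤ count (support y) → heaviest y h ⊆ᵇ support y
heaviest⊆support y h h≤supp i i∈ with support y i in Si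
... | true = refl
... | false = ⊥-elim (<-irrefl refl (begin-strict
  count (support y)         <⟨ count-strict (support y) (heaviest y h) i support⊆ i∈ Si ⟩
  count (heaviest y h)      ≡⟨ count-heaviest y h (≤-trans h≤supp (count≤ (support y))) ⟩
  h                         ≤⟨ h≤supp ⟩
  count (support y)         ∎))
  where
  open ≤-Reasoning
  -- yᵢ = 0 dominates every coordinate outside the set, so all of those vanish
  support⊆ : support y ⊆ᵇ heaviest y h
  support⊆ j Sj with heaviest y h j in j∈
  ... | true = refl
  ... | false = ⊥-elim (refutation (1 ≤? y i) Si (≤-trans (witness (1 ≤? y j) Sj) (heaviest-dominates y h i j i∈ j∈)))

clearTop : ∀ {n} → Position n → ℕ → Position n
clearTop y a = clearOn (heaviest y a) y

lowerTop : ∀ {n} → Position n → ℕ → Position n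
lowerTop y a = lowerOn (heaviest y a) y

clearTop≤lowerTop : ∀ {n} (y : Position n) a → clearTop y a ≤ᵖ lowerTop y a
clearTop≤lowerTop y a i with heaviest y a i
... | true = z≤n
... | false = ≤-refl

capacity-clearTop : ∀ {n} (y : Position n) a → a ≤ count (support y) →
  capacity (clearTop y a) 1 + a ≤ count (support y)
capacity-clearTop {n} y a a≤supp = begin
  capacity (clearTop y a) 1 + a                          ≡⟨ cong (capacity (clearTop y a) 1 +_) (count-heaviest y a a≤n) ⟨
  capacity (clearTop y a) 1 + count (heaviest y a)       ≡⟨ ∑-distrib-+ (λ i → clearTop y a i ⊓ 1) (λ i → 𝟙 (heaviest y a i)) ⟨
  sum (λ i → clearTop y a i ⊓ 1 + 𝟙 (heaviest y a i))    ≤⟨ sum-mono pointwise ⟩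
  count (support y)                                      ∎
  where
  open ≤-Reasoning
  a≤n : a ≤ n
  a≤n = ≤-trans a≤supp (count≤ (support y))
  pointwise : ∀ i → clearTop y a i ⊓ 1 + 𝟙 (heaviest y a i) ≤ 𝟙 (support y i)
  pointwise i with heaviest y a i in i∈
  ... | true rewrite heaviest⊆support y a a≤supp i i∈ = ≤-refl
  ... | false with y i
  ...   | zero = z≤n
  ...   | suc b = s≤s (≤-reflexive (trans (+-identityʳ (b ⊓ 0)) (⊓-zeroʳ b)))

-- If z+1 rounds fit after clearing the a heaviest coordinates, then z rounds
-- fit after merely lowering the a' heaviest ones, for a ≤ a' ≤ a + l: the
-- coordinates of rank a+1..a' are peeled as one round.
clear⇒lower : ∀ {n} l (y : Position n) a a' → a ≤ a' → a' ≤ a + l → a' ≤ count (support y) → ∀ z →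
  Feasible l (clearTop y a) (suc z) → Feasible l (lowerTop y a') z
clear⇒lower {n} l y a a' a≤a' a'≤a+l a'≤supp z feasible =
  feasible-mono l z lowered≤ (feasible-peel l D w z D⊆supp (peel-condition l D z w D≤l spill) feasible)
  where
  S = heaviest y a
  S' = heaviest y a'
  w = clearTop y a

  D : Subsetᵇ n
  D i = S' i ∧ not (S i)

  S⊆S' : S ⊆ᵇ S'
  S⊆S' = heaviest-⊆ y a≤a'

  D⊆supp : D ⊆ᵇ support w
  D⊆supp i Di with S i | S' i in S'i
  ... | false | true = heaviest⊆support y a' a'≤supp i S'i

  lowered≤ : lowerOn D w ≤ᵖ lowerTop y a'
  lowered≤ i with S i in Si | S' i in S'i
  ... | true | true = z≤n
  ... | true | false = ⊥-elim (false≢true (trans (sym S'i) (S⊆S' i Si)))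
  ... | false | true = ≤-refl
  ... | false | false = ≤-refl

  a'≤n : a' ≤ n
  a'≤n = ≤-trans a'≤supp (count≤ (support y))

  D≤l : count D ≤ l
  D≤l = +-cancelˡ-≤ a (count D) l (begin
    a + count D          ≡⟨ cong (_+ count D) (count-heaviest y a (≤-trans a≤a' a'≤n)) ⟨
    count S + count D    ≡⟨ count-split S' S D split ⟨
    count S'             ≡⟨ count-heaviest y a' a'≤n ⟩
    a'                   ≤⟨ a'≤a+l ⟩
    a + l                ∎)
    where
    open ≤-Reasoning
    split : ∀ i → 𝟙 (S' i) ≡ 𝟙 (S i) + 𝟙 (D i)
    split i with S i in Si | S' i in S'i
    ... | true | true = refl
    ... | true | false = ⊥-elim (false≢true (trans (sym S'i) (S⊆S' i Si)))
    ... | false | true = refl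
    ... | false | false = refl

  -- A coordinate j outside D that exceeds z is not cleared, hence not among
  -- the a' heaviest, so every member of D exceeds z as well.
  spill : ∀ j → aboveOutside D z w j ≡ true → l ≤ count (above z w) ⊎ D ⊆ᵇ above z w
  spill j out with S j | S' j in S'j
  ... | true | true = ⊥-elim (false≢true out)
  ... | true | false = ⊥-elim (false≢true out)
  ... | false | true = ⊥-elim (false≢true out)
  ... | false | false = inj₂ D⊆above
    where
    D⊆above : D ⊆ᵇ above z w
    D⊆above i Di with S i | S' i in S'i
    ... | false | true = confirm (suc z ≤? y i) (≤-trans (witness (suc z ≤? y j) out) (heaviest-dominates y a' i j S'i S'j))

ValueBetween : ∀ {n} → ℕ → Position n → ℕ → ℕ → Set
ValueBetween {n} l y a z = Σ (Position n) λ c → clearTop y a ≤ᵖ c × c ≤ᵖ lowerTop y a × ValueIs l c z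

-- Either z+1 rounds already fail at a lower cleared level, or they fit
-- there and clear⇒lower transports z rounds to the next lowered level.
level-search : ∀ {n} l (y : Position n) (h : ℕ → ℕ) → (∀ j → h j ≤ h (suc j)) → (∀ j → h (suc j) ≤ h j + l) →
  ∀ J → h J ≤ count (support y) → ∀ z →
  Feasible l (lowerTop y (h 0)) z → ¬ Feasible l (clearTop y (h J)) (suc z) →
  Σ ℕ λ j → j ≤ J × ValueBetween l y (h j) z
level-search l y h _ _ zero _ z lowered cleared =
  0 , ≤-refl , intermediate-value l _ _ z (clearTop≤lowerTop y (h 0)) cleared lowered
level-search l y h step≥ step≤ (suc J) J≤supp z lowered cleared with feasible? l (clearTop y (h J)) (suc z)
... | no cleared' with j , j≤J , between ← level-search l y h step≥ step≤ J (≤-trans (step≥ J) J≤supp) z lowered cleared'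
    = j , m≤n⇒m≤1+n j≤J , between
... | yes fits = suc J , ≤-refl ,
    intermediate-value l _ _ z (clearTop≤lowerTop y (h (suc J))) cleared
      (clear⇒lower l y (h J) (h (suc J)) (step≥ J) (step≤ J) J≤supp z fits)

clamp : ∀ k → ℕ → Fin (suc k)
clamp k zero = fzero
clamp zero (suc j) = fzero
clamp (suc k) (suc j) = fsuc (clamp k j)

clamp-step : ∀ k j → (Σ (Fin k) λ i → inject₁ i ≡ clamp k j × fsuc i ≡ clamp k (suc j)) ⊎ clamp k j ≡ clamp k (suc j)
clamp-step zero zero = inj₂ refl
clamp-step zero (suc j) = inj₂ refl
clamp-step (suc k) zero = inj₁ (fzero , refl , refl)
clamp-step (suc k) (suc j) with clamp-step k j
... | inj₁ (i , p , q) = inj₁ (fsuc i , cong fsuc p , cong fsuc q)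
... | inj₂ e = inj₂ (cong fsuc e)

clamp-top : ∀ k j → k ≤ j → clamp k j ≡ fromℕ k
clamp-top zero zero _ = refl
clamp-top zero (suc j) _ = refl
clamp-top (suc k) (suc j) (s≤s k≤j) = cong fsuc (clamp-top k j k≤j)

clamp-toℕ : ∀ k (i : Fin (suc k)) → clamp k (toℕ i) ≡ i
clamp-toℕ k fzero = refl
clamp-toℕ (suc k) (fsuc i) = cong fsuc (clamp-toℕ k i)

-- The hypergraph ⋃ⱼ binom(V, λⱼ) with the hypotheses of the theorem, on the
-- vertex set V = Fin n with n = n' + 1 (the theorem is vacuous for n = 0).
module Layers (n' k : ℕ) (λs : Fin (suc k) → ℕ)
  (increasing : (i : Fin k) → λs (inject₁ i) < λs (fsuc i))
  (λ₀>1 : 1 < λs fzero)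
  (gaps : (i : Fin k) → λs (fsuc i) ≤ λs (inject₁ i) + λs fzero)
  (extremes : λs fzero + λs (fromℕ k) ≡ suc n') where

  n = suc n'
  l = λs fzero
  μ = λs (fromℕ k)

  𝓗 : Hypergraph n
  𝓗 = UnionOfLayers λs

  L : ℕ → ℕ
  L j = λs (clamp k j)

  L-step≥ : ∀ j → L j ≤ L (suc j)
  L-step≥ j with clamp-step k j
  ... | inj₁ (i , p , q) = subst₂ _≤_ (cong λs p) (cong λs q) (<⇒≤ (increasing i))
  ... | inj₂ e = ≤-reflexive (cong λs e)

  L-step≤ : ∀ j → L (suc j) ≤ L j + l
  L-step≤ j with clamp-step k j
  ... | inj₁ (i , p , q) = subst₂ (λ u v → u ≤ v + l) (cong λs q) (cong λs p) (gaps i)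
  ... | inj₂ e = ≤-trans (≤-reflexive (cong λs (sym e))) (m≤m+n _ _)

  L-mono : ∀ {j j'} → j ≤ j' → L j ≤ L j'
  L-mono {j} j≤j' = propagate (λ j' → L j ≤ L j') (λ j' Lj≤ → ≤-trans Lj≤ (L-step≥ j')) j≤j' ≤-refl

  L-top : ∀ j → k ≤ j → L j ≡ μ
  L-top j k≤j = cong λs (clamp-top k j k≤j)

  L≤μ : ∀ j → L j ≤ μ
  L≤μ j with j ≤? k
  ... | yes j≤k = ≤-trans (L-mono j≤k) (≤-reflexive (L-top k ≤-refl))
  ... | no j≰k = ≤-reflexive (L-top j (<⇒≤ (≰⇒> j≰k)))

  l≤L : ∀ j → l ≤ L j
  l≤L j = L-mono z≤n

  l≥1 : 1 ≤ l
  l≥1 = <⇒≤ λ₀>1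

  n≡μ+l : n ≡ μ + l
  n≡μ+l = trans (sym extremes) (+-comm l μ)

  layer-edge : ∀ (S : Subsetᵇ n) j → count S ≡ L j → 𝓗 (tabulate S)
  layer-edge S j |S| = clamp k j , trans (∣tabulate∣ S) |S|

  large : ∀ H → 𝓗 H → l ≤ ∣ H ∣
  large H (i , |H|) = ≤-trans (≤-trans (l≤L (toℕ i)) (≤-reflexive (cong λs (clamp-toℕ k i)))) (≤-reflexive (sym |H|))

  open Tetris 𝓗 l l≥1 large (λ S → layer-edge S 0) public

  Goal : Position n → ℕ → Set
  Goal x z = ∃ λ x' → Move 𝓗 x x' × Long 𝓗 x' × IsTetris 𝓗 x' z

  reach : ∀ {x c : Position n} {z} → Move 𝓗 x c → Long 𝓗 c → ValueIs l c z → Goal x z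
  reach move long value = _ , move , long , value⇒tetris value

  bracket : ∀ p → l ≤ p → p < n → Σ ℕ λ J → L J ≤ p × p < L J + l
  bracket p l≤p p<n = search k 0 ≤-refl l≤p
    where
    search : ∀ fuel j → k ≤ j + fuel → L j ≤ p → Σ ℕ λ J → L J ≤ p × p < L J + l
    search zero j k≤j Lj≤p =
      j , Lj≤p , ≤-trans p<n (≤-reflexive (trans n≡μ+l (cong (_+ l) (sym (L-top j (≤-trans k≤j (≤-reflexive (+-identityʳ j))))))))
    search (suc fuel) j k≤j Lj≤p with suc p ≤? L j + l
    ... | yes p<Lj+l = j , Lj≤p , p<Lj+l
    ... | no p≮Lj+l = search fuel (suc j) (≤-trans k≤j (≤-reflexive (+-suc j fuel))) (≤-trans (L-step≤ j) (≤-pred (≰⇒> p≮Lj+l)))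

  -- Minimum 0.  With p positive coordinates, z+1 rounds already fail after
  -- clearing the L J heaviest ones for the level J bracketing p, while z
  -- rounds fit after lowering the l heaviest; level-search then yields a
  -- move on the L j heaviest coordinates, keeping the zero coordinate.
  zero-case : ∀ (x : Position n) i₀ → x i₀ ≡ 0 → ∀ z → Feasible l x (suc z) → Goal x z
  zero-case x i₀ xᵢ₀≡0 z feasible = bracketed (bracket p l≤p p<n)
    where
    p = count (support x)

    l≤p : l ≤ p
    l≤p = feasible⇒support l x z feasible

    p<n : p < n
    p<n = ≤-trans (count-strict (support x) (λ _ → true) i₀ (λ _ _ → refl) refl
                    (deny (1 ≤? x i₀) (λ 1≤xᵢ₀ → <-irrefl (sym xᵢ₀≡0) 1≤xᵢ₀)))
                  (≤-reflexive (count-all {n} (λ _ → true) (λ _ → refl)))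

    lowered : Feasible l (lowerTop x (L 0)) z
    lowered = clear⇒lower l x 0 (L 0) z≤n ≤-refl l≤p z feasible

    bracketed : (Σ ℕ λ J → L J ≤ p × p < L J + l) → Goal x z
    bracketed (J , LJ≤p , p<LJ+l) = found (level-search l x L L-step≥ L-step≤ J LJ≤p z lowered cleared)
      where
      cleared : ¬ Feasible l (clearTop x (L J)) (suc z)
      cleared fits = <-irrefl refl (begin-strict
        L J + l                                 ≡⟨ +-comm (L J) l ⟩
        l + L J                                 ≡⟨ cong (_+ L J) (*-identityʳ l) ⟨
        l * 1 + L J                             ≤⟨ +-monoˡ-≤ (L J) (feasible-≤ l (clearTop x (L J)) (s≤s z≤n) fits) ⟩
        capacity (clearTop x (L J)) 1 + L J     ≤⟨ capacity-clearTop x (L J) LJ≤p ⟩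
        p                                       <⟨ p<LJ+l ⟩
        L J + l                                 ∎)
        where open ≤-Reasoning

      found : (Σ ℕ λ j → j ≤ J × ValueBetween l x (L j) z) → Goal x z
      found (j , j≤J , c , clear≤c , c≤lower , value) = reach move long value
        where
        S = heaviest x (L j)
        Lj≤p : L j ≤ p
        Lj≤p = ≤-trans (L-mono j≤J) LJ≤p
        move : Move 𝓗 x c
        move = squeeze-move S (layer-edge S j (count-heaviest x (L j) (≤-trans Lj≤p (count≤ (support x)))))
                 (heaviest⊆support x (L j) Lj≤p) c≤lower
                 (λ i Si → ≤-trans (≤-reflexive (sym (clearOn-outside S x i Si))) (clear≤c i))
        long : Long 𝓗 c
        long = long-of-zero c i₀ (n≤0⇒n≡0 (≤-trans (c≤lower i₀) (≤-trans (lowerOn-≤ S x i₀) (≤-reflexive xᵢ₀≡0))))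

  -- Positive minimum m+1 attained at i₀, with m+1 ≤ z and z+1 rounds
  -- feasible.  y is x with i₀ cleared; its levels hh j = L j - 1 together
  -- with i₀ form L j-sets.
  module Positive (x : Position n) (i₀ : Fin n) (m : ℕ) (xᵢ₀≡ : x i₀ ≡ suc m) (min≡ : minPos x ≡ suc m)
    (z : ℕ) (m<z : suc m ≤ z) (feasible : Feasible l x (suc z)) (long : Long 𝓗 x) where

    positive : ∀ i → suc m ≤ x i
    positive i = subst (_≤ x i) min≡ (minPos-≤ x i)

    everything-positive : ∀ (S : Subsetᵇ n) → S ⊆ᵇ support x
    everything-positive S i _ = confirm (1 ≤? x i) (≤-trans (s≤s z≤n) (positive i))

    y : Position n
    y = clearOn ｛ i₀ ｝ x

    i₀∈ : ｛ i₀ ｝ i₀ ≡ true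
    i₀∈ = confirm (i₀ ≟ i₀) refl

    y-off-i₀ : ∀ i → ｛ i₀ ｝ i ≡ false → y i ≡ x i
    y-off-i₀ = clearOn-outside ｛ i₀ ｝ x

    others : Subsetᵇ n
    others i = not (｛ i₀ ｝ i)

    count-others : count others ≡ n'
    count-others = suc-injective (begin
      suc (count others)                ≡⟨ cong (_+ count others) (count-singleton i₀) ⟨
      count ｛ i₀ ｝ + count others      ≡⟨ count-complement ｛ i₀ ｝ ⟩
      n                                 ∎)
      where open ≡-Reasoning

    support-y : count (support y) ≡ n'
    support-y = trans (sum-cong-≗ (λ i → cong 𝟙 (support-others i))) count-others
      where
      support-others : ∀ i → support y i ≡ others i
      support-others i with i ≟ i₀
      ... | yes _ = refl
      ... | no _ = confirm (1 ≤? x i) (≤-trans (s≤s z≤n) (positive i))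

    μ≤n' : μ ≤ n'
    μ≤n' = ≤-pred (begin
      suc μ        ≡⟨ +-comm 1 μ ⟩
      μ + 1        ≤⟨ +-monoʳ-≤ μ l≥1 ⟩
      μ + l        ≡⟨ n≡μ+l ⟨
      n            ∎)
      where open ≤-Reasoning

    hh : ℕ → ℕ
    hh j = L j ∸ 1

    hh+1 : ∀ j → hh j + 1 ≡ L j
    hh+1 j = m∸n+n≡m (≤-trans l≥1 (l≤L j))

    hh≤supp : ∀ j → hh j ≤ count (support y)
    hh≤supp j = ≤-trans (m∸n≤m (L j) 1) (≤-trans (L≤μ j) (≤-trans μ≤n' (≤-reflexive (sym support-y))))

    hh-step≥ : ∀ j → hh j ≤ hh (suc j)
    hh-step≥ j = ∸-monoˡ-≤ 1 (L-step≥ j)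

    hh-step≤ : ∀ j → hh (suc j) ≤ hh j + l
    hh-step≤ j = ≤-trans (∸-monoˡ-≤ 1 (L-step≤ j)) (≤-reflexive (+-∸-comm l (≤-trans l≥1 (l≤L j))))

    i₀∉heaviest : ∀ a → a ≤ count (support y) → heaviest y a i₀ ≡ false
    i₀∉heaviest a a≤supp with heaviest y a i₀ in i₀∈H
    ... | false = refl
    ... | true = ⊥-elim (<-irrefl (sym (clearOn-inside ｛ i₀ ｝ x i₀ i₀∈))
                   (witness (1 ≤? y i₀) (heaviest⊆support y a a≤supp i₀ i₀∈H)))

    S⁺ : ℕ → Subsetᵇ n
    S⁺ a = heaviest y a ∪ᵇ ｛ i₀ ｝

    count-S⁺ : ∀ j → count (S⁺ (hh j)) ≡ L j
    count-S⁺ j = trans (count-insert (heaviest y (hh j)) i₀ (i₀∉heaviest (hh j) (hh≤supp j)))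
                   (trans (cong (_+ 1) (count-heaviest y (hh j) (≤-trans (hh≤supp j) (count≤ (support y))))) (hh+1 j))

    lowerTop≤ : ∀ a → lowerTop y a ≤ᵖ lowerOn (S⁺ a) x
    lowerTop≤ a i with heaviest y a i | i ≟ i₀
    ... | true | yes refl = z≤n
    ... | true | no _ = ≤-refl
    ... | false | yes refl = z≤n
    ... | false | no _ = ≤-refl

    clearTop-off-S⁺ : ∀ a i → S⁺ a i ≡ false → clearTop y a i ≡ x i
    clearTop-off-S⁺ a i i∉ = trans (clearOn-outside (heaviest y a) y i (∨-conicalˡ _ _ i∉)) (y-off-i₀ i (∨-conicalʳ _ _ i∉))

    -- Clearing a μ-set H avoiding i₀ leaves only the l coordinates off H,
    -- one of which (i₀) is at most z: z+1 rounds fail.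
    cleared-low : ∀ H → H ⊆ᵇ others → count H ≡ μ → ¬ Feasible l (clearOn H x) (suc z)
    cleared-low H H⊆others |H| = sparse⇒infeasible l (clearOn H x) z (λ i → not (H i)) (≤-reflexive |H̅|)
      (λ i H̅i → clearOn-inside H x i (not-false H̅i)) i₀ i₀∉H
      (≤-trans (≤-reflexive (clearOn-outside H x i₀ (not-true i₀∉H))) (≤-trans (≤-reflexive xᵢ₀≡) m<z))
      where
      |H̅| : count (λ i → not (H i)) ≡ l
      |H̅| = +-cancelˡ-≡ μ _ _ (trans (cong (_+ _) (sym |H|)) (trans (count-complement H) n≡μ+l))
      i₀∉H : not (H i₀) ≡ true
      i₀∉H with H i₀ in Hi₀
      ... | false = refl
      ... | true = ⊥-elim (false≢true (trans (sym (cong not i₀∈)) (H⊆others i₀ Hi₀)))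

    -- If all coordinates but i₀ exceed z, then lowering any set H and
    -- clearing any j ≠ i₀ leaves n - 2 ≥ l coordinates at height z.
    lowered-high : (∀ i → ｛ i₀ ｝ i ≡ false → z < x i) → ∀ H j → ｛ i₀ ｝ j ≡ false →
                   Feasible l (clearOn ｛ j ｝ (lowerOn H x)) z
    lowered-high tall H j j≢i₀ = tall⇒feasible l _ z R l≤R λ i Ri →
      let off = not-true Ri in
      ≤-trans (<⇒≤∸1 (tall i (∨-conicalˡ _ _ off)))
        (≤-trans (lowerOn-≥ H x i) (≤-reflexive (sym (clearOn-outside ｛ j ｝ (lowerOn H x) i (∨-conicalʳ _ _ off)))))
      where
      R : Subsetᵇ n
      R i = not ((｛ i₀ ｝ ∪ᵇ ｛ j ｝) i)
      l≤R : l ≤ count R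
      l≤R = +-cancelʳ-≤ 2 l (count R) (begin
        l + 2                                  ≤⟨ +-monoʳ-≤ l (≤-trans λ₀>1 (L≤μ 0)) ⟩
        l + μ                                  ≡⟨ trans (+-comm l μ) (sym n≡μ+l) ⟩
        n                                      ≡⟨ count-complement (｛ i₀ ｝ ∪ᵇ ｛ j ｝) ⟨
        count (｛ i₀ ｝ ∪ᵇ ｛ j ｝) + count R      ≡⟨ cong (_+ count R) (count-insert ｛ i₀ ｝ j j≢i₀) ⟩
        count ｛ i₀ ｝ + 1 + count R             ≡⟨ cong (λ c → c + 1 + count R) (count-singleton i₀) ⟩
        2 + count R                            ≡⟨ +-comm 2 (count R) ⟩
        count R + 2                            ∎)
        where open ≤-Reasoning

    -- Take a μ-set H avoiding i₀
    -- and a member j of it; between x cleared on H and x lowered on H with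
    -- j cleared lies a position of value z, reached by a move on H and
    -- keeping the zero at j.
    all-tall-case : (∀ i → ｛ i₀ ｝ i ≡ false → z < x i) → Goal x z
    all-tall-case tall = chosen (choose ∅ᵇ others μ (λ _ ()) (≤-trans (≤-reflexive (count-empty {n})) z≤n) μ≤others)
      where
      μ≤others : μ ≤ count others
      μ≤others = ≤-trans μ≤n' (≤-reflexive (sym count-others))

      chosen : (Σ (Subsetᵇ n) λ H → ∅ᵇ ⊆ᵇ H × H ⊆ᵇ others × count H ≡ μ) → Goal x z
      chosen (H , _ , H⊆others , |H|) = squeezed (member-of H (≤-trans (≤-trans l≥1 (L≤μ 0)) (≤-reflexive (sym |H|))))
        where
        squeezed : (Σ (Fin n) λ j → H j ≡ true) → Goal x z
        squeezed (j , Hj) = between (intermediate-value l a b z a≤b (cleared-low H H⊆others |H|)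
                                       (lowered-high tall H j (not-true (H⊆others j Hj))))
          where
          a b : Position n
          a = clearOn H x
          b = clearOn ｛ j ｝ (lowerOn H x)

          a≤b : a ≤ᵖ b
          a≤b i = by-cases (H i) refl
            where
            by-cases : ∀ h → H i ≡ h → a i ≤ b i
            by-cases true Hi = ≤-trans (≤-reflexive (clearOn-inside H x i Hi)) z≤n
            by-cases false Hi = ≤-reflexive (trans (clearOn-outside H x i Hi)
              (sym (trans (clearOn-outside ｛ j ｝ (lowerOn H x) i i≢j) (lowerOn-outside H x i Hi))))
              where
              i≢j : ｛ j ｝ i ≡ false
              i≢j = deny (i ≟ j) λ { refl → false≢true (trans (sym Hi) Hj) }

          between : (Σ (Position n) λ c → a ≤ᵖ c × c ≤ᵖ b × ValueIs l c z) → Goal x z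
          between (c , a≤c , c≤b , value) = reach move (long-of-zero c j cⱼ≡0) value
            where
            move : Move 𝓗 x c
            move = squeeze-move H (layer-edge H k (trans |H| (sym (L-top k ≤-refl)))) (everything-positive H)
                     (λ i → ≤-trans (c≤b i) (clearOn-≤ ｛ j ｝ (lowerOn H x) i))
                     (λ i Hi → ≤-trans (≤-reflexive (sym (clearOn-outside H x i Hi))) (a≤c i))
            cⱼ≡0 : c j ≡ 0
            cⱼ≡0 = n≤0⇒n≡0 (≤-trans (c≤b j) (≤-reflexive (clearOn-inside ｛ j ｝ (lowerOn H x) j (confirm (j ≟ j) refl))))

    -- Clearing the μ-1 heaviest
    -- coordinates of y leaves l+1 coordinates, among them i₀ (cleared) and
    -- one at most z, so z+1 rounds fail at the top level k.
    cleared-top : ∀ i₁ → ｛ i₀ ｝ i₁ ≡ false → x i₁ ≤ z → ¬ Feasible l (clearTop y (hh k)) (suc z)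
    cleared-top i₁ i₁≢i₀ x₁≤z = short-outside (heaviest y (hh k) i₁) refl
      where
      T = heaviest y (hh k)
      U : Subsetᵇ n
      U i = not (S⁺ (hh k) i)

      |S⁺| : count (S⁺ (hh k)) ≡ μ
      |S⁺| = trans (count-S⁺ k) (L-top k ≤-refl)

      |U| : count U ≡ l
      |U| = +-cancelˡ-≡ μ (count U) l
              (trans (cong (_+ count U) (sym |S⁺|)) (trans (count-complement (S⁺ (hh k))) n≡μ+l))

      S⁺<n : count (S⁺ (hh k)) < n
      S⁺<n = s≤s (≤-trans (≤-reflexive |S⁺|) μ≤n')

      vanish : ∀ i → U i ≡ false → clearTop y (hh k) i ≡ 0
      vanish i Ui with T i in Ti | i ≟ i₀
      ... | true | _ = refl
      ... | false | yes refl = refl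
      ... | false | no _ = ⊥-elim (false≢true (sym Ui))

      infeasible-at : ∀ j → U j ≡ true → y j ≤ z → ¬ Feasible l (clearTop y (hh k)) (suc z)
      infeasible-at j Uj yⱼ≤z = sparse⇒infeasible l (clearTop y (hh k)) z U (≤-reflexive |U|) vanish j Uj
        (≤-trans (≤-reflexive (clearOn-outside T y j (∨-conicalˡ _ _ (not-true Uj)))) yⱼ≤z)

      -- i₁ itself if it is not cleared; otherwise any uncleared j ≠ i₀,
      -- which is dominated by i₁.
      short-outside : ∀ t → T i₁ ≡ t → ¬ Feasible l (clearTop y (hh k)) (suc z)
      short-outside false Ti₁ = infeasible-at i₁ (cong not (trans (cong (_∨ ｛ i₀ ｝ i₁) Ti₁) i₁≢i₀))
                                  (≤-trans (≤-reflexive (y-off-i₀ i₁ i₁≢i₀)) x₁≤z)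
      short-outside true Ti₁ with j , S⁺j≡false ← nonmember-of (S⁺ (hh k)) S⁺<n =
        infeasible-at j (cong not S⁺j≡false)
          (≤-trans (heaviest-dominates y (hh k) i₁ j Ti₁ (∨-conicalˡ _ _ S⁺j≡false))
                   (≤-trans (≤-reflexive (y-off-i₀ i₁ i₁≢i₀)) x₁≤z))

    -- z rounds fit after lowering the l-1 heaviest coordinates of y:
    -- level-search along the levels hh j yields a move on S⁺ (hh j), which
    -- clears i₀.
    lowered-case : ∀ i₁ → ｛ i₀ ｝ i₁ ≡ false → x i₁ ≤ z → Feasible l (lowerTop y (hh 0)) z → Goal x z
    lowered-case i₁ i₁≢i₀ x₁≤z lowered =
      found (level-search l y hh hh-step≥ hh-step≤ k (hh≤supp k) z lowered (cleared-top i₁ i₁≢i₀ x₁≤z))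
      where
      found : (Σ ℕ λ j → j ≤ k × ValueBetween l y (hh j) z) → Goal x z
      found (j , _ , c , clear≤c , c≤lower , value) = reach move (long-of-zero c i₀ cᵢ₀≡0) value
        where
        move : Move 𝓗 x c
        move = squeeze-move (S⁺ (hh j)) (layer-edge (S⁺ (hh j)) j (count-S⁺ j)) (everything-positive (S⁺ (hh j)))
                 (λ i → ≤-trans (c≤lower i) (lowerTop≤ (hh j) i))
                 (λ i i∉ → ≤-trans (≤-reflexive (sym (clearTop-off-S⁺ (hh j) i i∉))) (clear≤c i))
        cᵢ₀≡0 : c i₀ ≡ 0
        cᵢ₀≡0 = n≤0⇒n≡0 (≤-trans (c≤lower i₀)
                  (≤-trans (lowerOn-≤ (heaviest y (hh j)) y i₀) (≤-reflexive (clearOn-inside ｛ i₀ ｝ x i₀ i₀∈))))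

    -- Lowering the l-set S⁺ (hh 0) of x keeps z rounds: a coordinate above
    -- z outside it dominates the l-1 heaviest coordinates of y, which then
    -- lie above z as well, so l coordinates exceed z.
    lowered-S⁺-high : Feasible l (lowerOn (S⁺ (hh 0)) x) z
    lowered-S⁺-high = feasible-peel l D x z (everything-positive D) (peel-condition l D z x (≤-reflexive (count-S⁺ 0)) spill) feasible
      where
      D = S⁺ (hh 0)
      K = heaviest y (hh 0)
      spill : ∀ j → aboveOutside D z x j ≡ true → l ≤ count (above z x) ⊎ D ⊆ᵇ above z x
      spill j out with Dj , xⱼ>z ← aboveOutside-split D z x j out = inj₁ (begin
        l                      ≡⟨ hh+1 0 ⟨
        hh 0 + 1               ≡⟨ cong (_+ 1) (count-heaviest y (hh 0) (≤-trans (hh≤supp 0) (count≤ (support y)))) ⟨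
        count K + 1            ≡⟨ +-comm (count K) 1 ⟩
        suc (count K)          ≤⟨ count-strict K (above z x) j K⊆above xⱼ>z (∨-conicalˡ _ _ Dj) ⟩
        count (above z x)      ∎)
        where
        open ≤-Reasoning
        K⊆above : K ⊆ᵇ above z x
        K⊆above i Ki = confirm (suc z ≤? x i) (begin
          suc z                ≤⟨ witness (suc z ≤? x j) xⱼ>z ⟩
          x j                  ≡⟨ y-off-i₀ j (∨-conicalʳ _ _ Dj) ⟨
          y j                  ≤⟨ heaviest-dominates y (hh 0) i j Ki (∨-conicalˡ _ _ Dj) ⟩
          y i                  ≤⟨ clearOn-≤ ｛ i₀ ｝ x i ⟩
          x i                  ∎)

    -- A position at most m at i₀ and at least x - 1 elsewhere has smaller
    -- minimum and larger reduction than x, so it inherits longness.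
    long-near : ∀ (c : Position n) → c i₀ ≤ m → (∀ i → ｛ i₀ ｝ i ≡ false → x i ∸ 1 ≤ c i) → Long 𝓗 c
    long-near c cᵢ₀≤m near = long-transfer long min≤ reduce≤
      where
      min-c≤m : minPos c ≤ m
      min-c≤m = ≤-trans (minPos-≤ c i₀) cᵢ₀≤m

      min≤ : minPos c ≤ minPos x
      min≤ = ≤-trans min-c≤m (≤-trans (n≤1+n m) (≤-reflexive (sym min≡)))

      reduce≤ : reduce x ≤ᵖ reduce c
      reduce≤ i with i ≟ i₀
      ... | yes refl = ≤-trans (≤-reflexive (trans (cong₂ _∸_ xᵢ₀≡ min≡) (n∸n≡0 (suc m)))) z≤n
      ... | no i≢i₀ = subst (λ v → x i ∸ v ≤ c i ∸ minPos c) (sym min≡) (∸-mono xᵢ≤1+cᵢ (s≤s min-c≤m))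
        where
        xᵢ≤1+cᵢ : x i ≤ suc (c i)
        xᵢ≤1+cᵢ = ≤-trans (m≤n+m∸n (x i) 1) (s≤s (near i (deny (i ≟ i₀) i≢i₀)))

    -- Otherwise y lowered at level hh 0 admits no z+1 rounds while x
    -- lowered on S⁺ (hh 0) admits z; the intermediate position is reached
    -- by a move on S⁺ (hh 0) and is long by long-near.
    unlowered-case : ¬ Feasible l (lowerTop y (hh 0)) z → Goal x z
    unlowered-case unlowered =
      between (intermediate-value l a b z (lowerTop≤ (hh 0)) (λ fits → unlowered (feasible-pred l a z fits)) lowered-S⁺-high)
      where
      D = S⁺ (hh 0)
      a = lowerTop y (hh 0)
      b = lowerOn D x

      between : (Σ (Position n) λ c → a ≤ᵖ c × c ≤ᵖ b × ValueIs l c z) → Goal x z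
      between (c , a≤c , c≤b , value) = reach move (long-near c cᵢ₀≤m near) value
        where
        move : Move 𝓗 x c
        move = squeeze-move D (layer-edge D 0 (count-S⁺ 0)) (everything-positive D) c≤b
                 (λ i i∉ → ≤-trans (≤-reflexive (sym (clearTop-off-S⁺ (hh 0) i i∉)))
                                   (≤-trans (clearTop≤lowerTop y (hh 0) i) (a≤c i)))
        cᵢ₀≤m : c i₀ ≤ m
        cᵢ₀≤m = ≤-trans (c≤b i₀) (≤-reflexive (trans (lowerOn-inside D x i₀ (trans (cong (heaviest y (hh 0) i₀ ∨_) i₀∈) (∨-zeroʳ (heaviest y (hh 0) i₀))))
                                                     (cong (_∸ 1) xᵢ₀≡)))
        near : ∀ i → ｛ i₀ ｝ i ≡ false → x i ∸ 1 ≤ c i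
        near i i≢i₀ = begin
          x i ∸ 1            ≡⟨ cong (_∸ 1) (y-off-i₀ i i≢i₀) ⟨
          y i ∸ 1            ≤⟨ lowerOn-≥ (heaviest y (hh 0)) y i ⟩
          a i                ≤⟨ a≤c i ⟩
          c i                ∎
          where open ≤-Reasoning

    result : Goal x z
    result with any? (λ i → (｛ i₀ ｝ i ≟ᵇ false) ×-dec (x i ≤? z))
    ... | no none = all-tall-case (λ i i≢i₀ → ≰⇒> (λ xᵢ≤z → none (i , i≢i₀ , xᵢ≤z)))
    ... | yes (i₁ , i₁≢i₀ , x₁≤z) with feasible? l (lowerTop y (hh 0)) z
    ...   | yes lowered = lowered-case i₁ i₁≢i₀ x₁≤z lowered
    ...   | no unlowered = unlowered-case unlowered

  move-to-value : ∀ (x : Position n) → Long 𝓗 x → ∀ T z → IsTetris 𝓗 x T → minPos x ≤ z → z < T → Goal x z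
  move-to-value x long T z tetris min≤z z<T with i₀ , xᵢ₀≡min ← minPos-attained x = by-minimum (minPos x) refl
    where
    feasible : Feasible l x (suc z)
    feasible = below-tetris z tetris z<T

    by-minimum : ∀ m → minPos x ≡ m → Goal x z
    by-minimum zero min≡0 = zero-case x i₀ (trans xᵢ₀≡min min≡0) z feasible
    by-minimum (suc m) min≡ =
      Positive.result x i₀ m (trans xᵢ₀≡min min≡) min≡ z (subst (_≤ z) min≡ min≤z) feasible long

lemma8 : (n k : ℕ) (λs : Fin (suc k) → ℕ)
    → 0 < λs fzero
    → ((i : Fin k) → λs (inject₁ i) < λs (fsuc i))
    → λs (fromℕ k) ≤ n
    → 1 < λs fzero
    → ((i : Fin k) → λs (fsuc i) ≤ λs (inject₁ i) + λs fzero)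
    → λs fzero + λs (fromℕ k) ≡ n
    → (x : Position n) → Long (UnionOfLayers λs) x
    → (T z : ℕ) → IsTetris (UnionOfLayers λs) x T
    → minPos x ≤ z → z < T
    → ∃ λ x' → Move (UnionOfLayers λs) x x' × Long (UnionOfLayers λs) x' × IsTetris (UnionOfLayers λs) x' z
lemma8 zero k λs _ _ _ λ₀>1 _ extremes = ⊥-elim (n≮0 (subst (1 <_) (m+n≡0⇒m≡0 (λs fzero) extremes) λ₀>1))
lemma8 (suc n') k λs _ increasing _ λ₀>1 gaps extremes =
  Layers.move-to-value n' k λs increasing λ₀>1 gaps extremes
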